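{- The equation $7x^2 + 25^{2y} = 2^{z+2}$ has no solution in positive integers $x,y,z$. -}

{-# OPTIONS --safe #-}
module Submission where

-- Put w = 25^y, so that the equation reads w² + 7x² = 2^(z+2).
--
-- For even z reduce mod 5: 7x² is 0, 2 or 3 while 4^(z/2+1) is 1 or 4.  For z = 1 the right side 8
-- is smaller than w².  For odd z ≥ 3 we descend on odd solutions of w² + 7x² = 2^(5+j): changing
-- the sign of x we may write x = w + 4t, and w² + 7(w+4t)² = 2((2w+7t)² + 7t²) turns (w, x) into
-- the odd solution (2w+7t, t) of the next smaller power.  Since the smaller norm is divisible by 32,
-- w + t ≡ 0 (mod 8), whence x² ≡ 9t² (mod 16); by induction x² ≡ 9^j (mod 16).  Here j = z - 3 is
-- even, so x² ≡ 1, and w ≡ 1 (mod 8) gives w² ≡ 1 (mod 16): then w² + 7x² ≡ 8 (mod 16), which is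
-- not a multiple of 2^(5+j).

open import Data.Empty using (⊥-elim)
open import Data.List.Base using (_∷_; [])
open import Data.Product using (∃; _×_; _,_)
open import Data.Sum using (_⊎_; inj₁; inj₂; [_,_]′)
open import Relation.Binary.PropositionalEquality
open import Relation.Nullary using (¬_)

module Norm where
  import Data.Nat as ℕ
  open import Data.Nat using (zero; suc; z≤n; s≤s)
  open import Data.Nat.Properties using (even≢odd; m≤n+m; m≤m+n; ≤-trans; ≤⇒≯; *-mono-≤; *-monoʳ-≤)
  open import Data.Integer.Base using (ℤ; +_; -[1+_]; -_; _+_; _-_; _*_; _^_; ∣_∣; NonZero)
  open import Data.Integer.Properties
    using (*-comm; +-identityˡ; *-cancelˡ-≡; abs-*; pos-+; pos-*; +-injective; ^-*-assoc; ^-distribˡ-+-*)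
  open import Data.Integer.DivMod using (_%_; _/_; n%d<d; a≡a%n+[a/n]*n)
  open import Data.Integer.Tactic.RingSolver using (solve)
  open ≡-Reasoning

  infix 4 _≡_mod_
  data _≡_mod_ (a b n : ℤ) : Set where
    _,_ : ∀ k → a ≡ b + n * k → a ≡ b mod n

  ≡mod-reflexive : ∀ {a b n} → a ≡ b → a ≡ b mod n
  ≡mod-reflexive {a} {b} {n} a≡b = + 0 , trans a≡b (solve (b ∷ n ∷ []))

  ≡mod-trans : ∀ {a b c n} → a ≡ b mod n → b ≡ c mod n → a ≡ c mod n
  ≡mod-trans {a} {b} {c} {n} (k , a≡b+nk) (l , b≡c+nl) = l + k , (begin
    a                 ≡⟨ a≡b+nk ⟩
    b + n * k         ≡⟨ cong (_+ n * k) b≡c+nl ⟩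
    c + n * l + n * k ≡⟨ solve (c ∷ n ∷ k ∷ l ∷ []) ⟩
    c + n * (l + k)   ∎)

  ≡mod-* : ∀ {a b c d n} → a ≡ b mod n → c ≡ d mod n → a * c ≡ b * d mod n
  ≡mod-* {a} {b} {c} {d} {n} (k , a≡b+nk) (l , c≡d+nl) = b * l + d * k + n * k * l , (begin
    a * c                                   ≡⟨ cong₂ _*_ a≡b+nk c≡d+nl ⟩
    (b + n * k) * (d + n * l)               ≡⟨ solve (b ∷ d ∷ n ∷ k ∷ l ∷ []) ⟩
    b * d + n * (b * l + d * k + n * k * l) ∎)

  ≡mod-*ˡ : ∀ c {a b n} → a ≡ b mod n → c * a ≡ c * b mod n
  ≡mod-*ˡ c {a} {b} = ≡mod-* {c} {c} {a} {b} (≡mod-reflexive refl)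

  ^-≡1-mod : ∀ {a n} k → a ≡ + 1 mod n → a ^ k ≡ + 1 mod n
  ^-≡1-mod zero    _   = ≡mod-reflexive refl
  ^-≡1-mod (suc k) a≡1 = ≡mod-* a≡1 (^-≡1-mod k a≡1)

  2^[k+j]≡0-mod-2^k : ∀ k j → (+ 2) ^ (k ℕ.+ j) ≡ + 0 mod (+ 2) ^ k
  2^[k+j]≡0-mod-2^k k j = (+ 2) ^ j , (begin
    (+ 2) ^ (k ℕ.+ j)           ≡⟨ ^-distribˡ-+-* (+ 2) k j ⟩
    (+ 2) ^ k * (+ 2) ^ j       ≡⟨ +-identityˡ _ ⟨
    + 0 + (+ 2) ^ k * (+ 2) ^ j ∎)

  Odd Even : ℤ → Set
  Odd a  = a ≡ + 1 mod + 2
  Even a = a ≡ + 0 mod + 2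

  even-or-odd : ∀ a → Even a ⊎ Odd a
  even-or-odd a with a % + 2 | n%d<d a (+ 2) | a≡a%n+[a/n]*n a (+ 2)
  ... | 0           | _            | a≡ = inj₁ (a / + 2 , trans a≡ (cong (_+_ (+ 0)) (*-comm (a / + 2) (+ 2))))
  ... | 1           | _            | a≡ = inj₂ (a / + 2 , trans a≡ (cong (_+_ (+ 1)) (*-comm (a / + 2) (+ 2))))
  ... | suc (suc _) | s≤s (s≤s ()) | _

  ≡n⇒≢0-mod-2n : ∀ n .{{_ : NonZero n}} {a} → a ≡ n mod + 2 * n → ¬ a ≡ + 0 mod + 2 * n
  ≡n⇒≢0-mod-2n n {a} (k , a≡n+2nk) (l , a≡0+2nl) = even≢odd ∣ l - k ∣ 0 (sym 1≡2∣l-k∣)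
    where
    1+2k≡2l : + 1 + + 2 * k ≡ + 2 * l
    1+2k≡2l = *-cancelˡ-≡ n _ _ (begin
      n * (+ 1 + + 2 * k) ≡⟨ solve (n ∷ k ∷ []) ⟩
      n + + 2 * n * k     ≡⟨ a≡n+2nk ⟨
      a                   ≡⟨ a≡0+2nl ⟩
      + 0 + + 2 * n * l   ≡⟨ solve (n ∷ l ∷ []) ⟩
      n * (+ 2 * l)       ∎)
    1≡2[l-k] : + 1 ≡ + 2 * (l - k)
    1≡2[l-k] = begin
      + 1                     ≡⟨ solve (k ∷ []) ⟩
      + 1 + + 2 * k - + 2 * k ≡⟨ cong (_- + 2 * k) 1+2k≡2l ⟩
      + 2 * l - + 2 * k       ≡⟨ solve (l ∷ k ∷ []) ⟩
      + 2 * (l - k)           ∎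
    1≡2∣l-k∣ : 1 ≡ 2 ℕ.* ∣ l - k ∣
    1≡2∣l-k∣ = trans (cong ∣_∣ 1≡2[l-k]) (abs-* (+ 2) (l - k))

  odd⇒¬even : ∀ {a} → Odd a → ¬ Even a
  odd⇒¬even = ≡n⇒≢0-mod-2n (+ 1)

  odd-* : ∀ {a b} → Odd a → Odd b → Odd (a * b)
  odd-* (k , refl) (l , refl) = k + l + + 2 * k * l , solve (k ∷ l ∷ [])

  ≡1-mod-8⇒odd : ∀ {a} → a ≡ + 1 mod + 8 → Odd a
  ≡1-mod-8⇒odd (k , refl) = + 4 * k , solve (k ∷ [])

  k*[k+1]-even : ∀ k → Even (k * (k + + 1))
  k*[k+1]-even k with even-or-odd k
  ... | inj₁ (l , k≡2l) = l * (k + + 1) , (begin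
    k * (k + + 1)               ≡⟨ cong (_* (k + + 1)) k≡2l ⟩
    (+ 0 + + 2 * l) * (k + + 1) ≡⟨ solve (l ∷ k ∷ []) ⟩
    + 0 + + 2 * (l * (k + + 1)) ∎)
  ... | inj₂ (l , k≡1+2l) = k * (l + + 1) , (begin
    k * (k + + 1)               ≡⟨ cong (λ s → k * (s + + 1)) k≡1+2l ⟩
    k * (+ 1 + + 2 * l + + 1)   ≡⟨ solve (k ∷ l ∷ []) ⟩
    + 0 + + 2 * (k * (l + + 1)) ∎)

  odd²≡1-mod-8 : ∀ {a} → Odd a → a * a ≡ + 1 mod + 8
  odd²≡1-mod-8 {a} (k , a≡1+2k) with k*[k+1]-even k
  ... | m , k[k+1]≡2m = m , (begin
    a * a                             ≡⟨ cong₂ _*_ a≡1+2k a≡1+2k ⟩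
    (+ 1 + + 2 * k) * (+ 1 + + 2 * k) ≡⟨ solve (k ∷ []) ⟩
    + 1 + + 4 * (k * (k + + 1))       ≡⟨ cong (λ s → + 1 + + 4 * s) k[k+1]≡2m ⟩
    + 1 + + 4 * (+ 0 + + 2 * m)       ≡⟨ solve (m ∷ []) ⟩
    + 1 + + 8 * m                     ∎)

  odd*v≡0⇒v≡0-mod-8 : ∀ {u v} → Odd u → u * v ≡ + 0 mod + 8 → v ≡ + 0 mod + 8
  odd*v≡0⇒v≡0-mod-8 {u} {v} u-odd (g , uv≡8g) with odd²≡1-mod-8 u-odd
  ... | k , u²≡1+8k = g * u - k * v , (begin
    v                                               ≡⟨ solve (u ∷ v ∷ []) ⟩
    u * v * u - (u * u - + 1) * v                   ≡⟨ cong₂ (λ p s → p * u - (s - + 1) * v) uv≡8g u²≡1+8k ⟩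
    (+ 0 + + 8 * g) * u - (+ 1 + + 8 * k - + 1) * v ≡⟨ solve (u ∷ v ∷ g ∷ k ∷ []) ⟩
    + 0 + + 8 * (g * u - k * v)                     ∎)

  ≡1-mod-8⇒square≡1-mod-16 : ∀ {a} → a ≡ + 1 mod + 8 → a * a ≡ + 1 mod + 16
  ≡1-mod-8⇒square≡1-mod-16 (k , refl) = k + + 4 * k * k , solve (k ∷ [])

  norm : ℤ → ℤ → ℤ
  norm w x = w * w + + 7 * (x * x)

  square-abs : ∀ x → x * x ≡ + ∣ x ∣ * + ∣ x ∣
  square-abs (+ n)    = refl
  square-abs -[1+ n ] = refl

  norm-abs : ∀ w x → norm w x ≡ norm (+ ∣ w ∣) (+ ∣ x ∣)
  norm-abs w x = cong₂ (λ p q → p + + 7 * q) (square-abs w) (square-abs x)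

  pos-norm : ∀ m n → + (m ℕ.* m ℕ.+ 7 ℕ.* (n ℕ.* n)) ≡ norm (+ m) (+ n)
  pos-norm m n = begin
    + (m ℕ.* m ℕ.+ 7 ℕ.* (n ℕ.* n))   ≡⟨ pos-+ (m ℕ.* m) (7 ℕ.* (n ℕ.* n)) ⟩
    + (m ℕ.* m) + + (7 ℕ.* (n ℕ.* n)) ≡⟨ cong₂ _+_ (pos-* m m) (pos-* 7 (n ℕ.* n)) ⟩
    + m * + m + + 7 * + (n ℕ.* n)     ≡⟨ cong (λ s → + m * + m + + 7 * s) (pos-* n n) ⟩
    norm (+ m) (+ n)                  ∎

  pos-^ : ∀ m n → + (m ℕ.^ n) ≡ (+ m) ^ n
  pos-^ m zero    = refl
  pos-^ m (suc n) = trans (pos-* m (m ℕ.^ n)) (cong (+ m *_) (pos-^ m n))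

  odd-norm : ∀ {w x} → Odd w → Even x → Odd (norm w x)
  odd-norm {w} {x} (a , w≡1+2a) (b , x≡2b) = + 2 * a + + 2 * (a * a) + + 14 * (b * b) , (begin
    norm w x                                                         ≡⟨ cong₂ norm w≡1+2a x≡2b ⟩
    (+ 1 + + 2 * a) * (+ 1 + + 2 * a) + + 7 * ((+ 0 + + 2 * b) * (+ 0 + + 2 * b))
                                                                     ≡⟨ solve (a ∷ b ∷ []) ⟩
    + 1 + + 2 * (+ 2 * a + + 2 * (a * a) + + 14 * (b * b))           ∎)

  norm≡32⇒x²≡1 : ∀ {w x} → Odd x → norm w x ≡ + 32 → x * x ≡ + 1
  norm≡32⇒x²≡1 {w} {x} x-odd norm≡32 = by-cases ∣ x ∣ (square-abs x) 7∣x∣²≤32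
    where
    7∣x∣²≤32 : 7 ℕ.* (∣ x ∣ ℕ.* ∣ x ∣) ℕ.≤ 32
    7∣x∣²≤32 = subst (7 ℕ.* (∣ x ∣ ℕ.* ∣ x ∣) ℕ.≤_)
      (+-injective (trans (pos-norm ∣ w ∣ ∣ x ∣) (trans (sym (norm-abs w x)) norm≡32)))
      (m≤n+m _ (∣ w ∣ ℕ.* ∣ w ∣))
    by-cases : ∀ X → x * x ≡ + X * + X → 7 ℕ.* (X ℕ.* X) ℕ.≤ 32 → x * x ≡ + 1
    by-cases 0                   x²≡0 _      = ⊥-elim (odd⇒¬even (odd-* x-odd x-odd) (+ 0 , x²≡0))
    by-cases 1                   x²≡1 _      = x²≡1
    by-cases 2                   x²≡4 _      = ⊥-elim (odd⇒¬even (odd-* x-odd x-odd) (+ 2 , x²≡4))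
    by-cases (suc (suc (suc n))) _    7X²≤32 =
      ⊥-elim (≤⇒≯ 7X²≤32 (≤-trans (m≤m+n 33 30) (*-monoʳ-≤ 7 (*-mono-≤ 3≤X 3≤X))))
      where
      3≤X : 3 ℕ.≤ suc (suc (suc n))
      3≤X = s≤s (s≤s (s≤s z≤n))

  odd⇒x²≡[w+4t]² : ∀ {w x} → Odd w → Odd x → ∃ λ t → x * x ≡ (w + + 4 * t) * (w + + 4 * t)
  odd⇒x²≡[w+4t]² {w} {x} (a , w≡1+2a) (b , x≡1+2b) with even-or-odd (a - b)
  ... | inj₁ (u , a-b≡2u) = - u , cong (λ s → s * s) x≡w+4t
    where
    x≡w+4t : x ≡ w + + 4 * - u
    x≡w+4t = begin
      x                             ≡⟨ x≡1+2b ⟩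
      + 1 + + 2 * b                 ≡⟨ solve (a ∷ b ∷ []) ⟩
      + 1 + + 2 * a - + 2 * (a - b) ≡⟨ cong₂ (λ p d → p - + 2 * d) (sym w≡1+2a) a-b≡2u ⟩
      w - + 2 * (+ 0 + + 2 * u)     ≡⟨ solve (w ∷ u ∷ []) ⟩
      w + + 4 * - u                 ∎
  ... | inj₂ (u , a-b≡1+2u) = - (+ 1 + b + u) , (begin
    x * x                                                     ≡⟨ solve (x ∷ []) ⟩
    - x * - x                                                 ≡⟨ cong (λ s → s * s) -x≡w+4t ⟩
    (w + + 4 * - (+ 1 + b + u)) * (w + + 4 * - (+ 1 + b + u)) ∎)
    where
    -x≡w+4t : - x ≡ w + + 4 * - (+ 1 + b + u)
    -x≡w+4t = begin
      - x                                           ≡⟨ cong -_ x≡1+2b ⟩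
      - (+ 1 + + 2 * b)                             ≡⟨ solve (a ∷ b ∷ []) ⟩
      + 1 + + 2 * a - + 2 * (a - b) - + 2 - + 4 * b
        ≡⟨ cong₂ (λ p d → p - + 2 * d - + 2 - + 4 * b) (sym w≡1+2a) a-b≡1+2u ⟩
      w - + 2 * (+ 1 + + 2 * u) - + 2 - + 4 * b     ≡⟨ solve (w ∷ b ∷ u ∷ []) ⟩
      w + + 4 * - (+ 1 + b + u)                     ∎

  norm-halving : ∀ w t → norm w (w + + 4 * t) ≡ + 2 * norm (+ 2 * w + + 7 * t) t
  norm-halving w t = begin
    w * w + + 7 * ((w + + 4 * t) * (w + + 4 * t))                     ≡⟨ solve (w ∷ t ∷ []) ⟩
    + 2 * ((+ 2 * w + + 7 * t) * (+ 2 * w + + 7 * t) + + 7 * (t * t)) ∎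

  norm[2w+7t,t]≡4-mod-8 : ∀ {w t} → Odd w → Even t → norm (+ 2 * w + + 7 * t) t ≡ + 4 mod + 8
  norm[2w+7t,t]≡4-mod-8 {w} {t} (a , w≡1+2a) (v , t≡2v) =
    + 2 * a + + 2 * (a * a) + + 7 * v + + 14 * (a * v) + + 28 * (v * v) , (begin
      norm (+ 2 * w + + 7 * t) t
        ≡⟨ cong₂ (λ p q → norm (+ 2 * p + + 7 * q) q) w≡1+2a t≡2v ⟩
      (+ 2 * (+ 1 + + 2 * a) + + 7 * (+ 0 + + 2 * v)) * (+ 2 * (+ 1 + + 2 * a) + + 7 * (+ 0 + + 2 * v))
        + + 7 * ((+ 0 + + 2 * v) * (+ 0 + + 2 * v))
        ≡⟨ solve (a ∷ v ∷ []) ⟩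
      + 4 + + 8 * (+ 2 * a + + 2 * (a * a) + + 7 * v + + 14 * (a * v) + + 28 * (v * v))
        ∎)

  odd-2w+7t : ∀ {w t} → Odd w → Odd t → Odd (+ 2 * w + + 7 * t)
  odd-2w+7t {w} {t} (a , w≡1+2a) (c , t≡1+2c) = + 4 + + 2 * a + + 7 * c , (begin
    + 2 * w + + 7 * t                             ≡⟨ cong₂ (λ p q → + 2 * p + + 7 * q) w≡1+2a t≡1+2c ⟩
    + 2 * (+ 1 + + 2 * a) + + 7 * (+ 1 + + 2 * c) ≡⟨ solve (a ∷ c ∷ []) ⟩
    + 1 + + 2 * (+ 4 + + 2 * a + + 7 * c)         ∎)

  w+t≡0-mod-8 : ∀ {w} t → Odd w → norm (+ 2 * w + + 7 * t) t ≡ + 0 mod + 32 → w + t ≡ + 0 mod + 8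
  w+t≡0-mod-8 {w} t (a , w≡1+2a) (P , N≡32P) =
    odd*v≡0⇒v≡0-mod-8 w+6t-odd (P - t * t , [w+6t][w+t]≡8[P-t²])
    where
    w+6t-odd : Odd (w + + 6 * t)
    w+6t-odd = a + + 3 * t , (begin
      w + + 6 * t               ≡⟨ cong (_+ + 6 * t) w≡1+2a ⟩
      + 1 + + 2 * a + + 6 * t   ≡⟨ solve (a ∷ t ∷ []) ⟩
      + 1 + + 2 * (a + + 3 * t) ∎)
    [w+6t][w+t]≡8[P-t²] : (w + + 6 * t) * (w + t) ≡ + 0 + + 8 * (P - t * t)
    [w+6t][w+t]≡8[P-t²] = *-cancelˡ-≡ (+ 4) _ _ (begin
      + 4 * ((w + + 6 * t) * (w + t))
        ≡⟨ solve (w ∷ t ∷ []) ⟩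
      (+ 2 * w + + 7 * t) * (+ 2 * w + + 7 * t) + + 7 * (t * t) - + 32 * (t * t)
        ≡⟨ cong (_- + 32 * (t * t)) N≡32P ⟩
      + 0 + + 32 * P - + 32 * (t * t)
        ≡⟨ solve (P ∷ t ∷ []) ⟩
      + 4 * (+ 0 + + 8 * (P - t * t))
        ∎)

  [w+4t]²≡9t²-mod-16 : ∀ w t → w + t ≡ + 0 mod + 8 →
                       (w + + 4 * t) * (w + + 4 * t) ≡ + 9 * (t * t) mod + 16
  [w+4t]²≡9t²-mod-16 w t (e , w+t≡8e) = e * (+ 4 * e + + 3 * t) , (begin
    (w + + 4 * t) * (w + + 4 * t)                               ≡⟨ solve (w ∷ t ∷ []) ⟩
    + 9 * (t * t) + (w + t) * (w + t + + 6 * t)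
      ≡⟨ cong (λ s → + 9 * (t * t) + s * (s + + 6 * t)) w+t≡8e ⟩
    + 9 * (t * t) + (+ 0 + + 8 * e) * (+ 0 + + 8 * e + + 6 * t) ≡⟨ solve (t ∷ e ∷ []) ⟩
    + 9 * (t * t) + + 16 * (e * (+ 4 * e + + 3 * t))            ∎)

  x²≡9^j-mod-16 : ∀ j {w x} → Odd w → Odd x → norm w x ≡ (+ 2) ^ (5 ℕ.+ j) →
                  x * x ≡ (+ 9) ^ j mod + 16
  x²≡9^j-mod-16 zero    {w} _ x-odd norm≡32 = ≡mod-reflexive (norm≡32⇒x²≡1 {w} x-odd norm≡32)
  x²≡9^j-mod-16 (suc j) {w} {x} w-odd x-odd norm≡ with odd⇒x²≡[w+4t]² w-odd x-odd
  ... | t , x²≡[w+4t]² =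
    ≡mod-trans (≡mod-reflexive x²≡[w+4t]²)
      (≡mod-trans ([w+4t]²≡9t²-mod-16 w t (w+t≡0-mod-8 t w-odd N≡0-mod-32))
        (≡mod-*ˡ (+ 9) (x²≡9^j-mod-16 j (odd-2w+7t w-odd t-odd) t-odd N≡)))
    where
    N : ℤ
    N = norm (+ 2 * w + + 7 * t) t
    N≡ : N ≡ (+ 2) ^ (5 ℕ.+ j)
    N≡ = *-cancelˡ-≡ (+ 2) N ((+ 2) ^ (5 ℕ.+ j)) (begin
      + 2 * N              ≡⟨ norm-halving w t ⟨
      norm w (w + + 4 * t) ≡⟨ cong (λ s → w * w + + 7 * s) x²≡[w+4t]² ⟨
      norm w x             ≡⟨ norm≡ ⟩
      (+ 2) ^ (6 ℕ.+ j)    ∎)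
    N≡0-mod-32 : N ≡ + 0 mod + 32
    N≡0-mod-32 = ≡mod-trans (≡mod-reflexive N≡) (2^[k+j]≡0-mod-2^k 5 j)
    t-odd : Odd t
    t-odd with even-or-odd t
    ... | inj₂ t-odd  = t-odd
    ... | inj₁ t-even = ⊥-elim (≡n⇒≢0-mod-2n (+ 4) (norm[2w+7t,t]≡4-mod-8 w-odd t-even)
                                 (≡mod-trans (≡mod-reflexive N≡) (2^[k+j]≡0-mod-2^k 3 (2 ℕ.+ j))))

  norm≢2^[5+2j] : ∀ j {w} x → w ≡ + 1 mod + 8 → norm w x ≢ (+ 2) ^ (5 ℕ.+ 2 ℕ.* j)
  norm≢2^[5+2j] j {w} x w≡1-mod-8 norm≡ = [ x-even-case , x-odd-case ]′ (even-or-odd x)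
    where
    w-odd : Odd w
    w-odd = ≡1-mod-8⇒odd w≡1-mod-8
    x-even-case : ¬ Even x
    x-even-case x-even = odd⇒¬even (odd-norm w-odd x-even)
      (≡mod-trans (≡mod-reflexive norm≡) (2^[k+j]≡0-mod-2^k 1 (4 ℕ.+ 2 ℕ.* j)))
    x-odd-case : ¬ Odd x
    x-odd-case x-odd = ≡n⇒≢0-mod-2n (+ 8) norm≡8-mod-16
      (≡mod-trans (≡mod-reflexive norm≡) (2^[k+j]≡0-mod-2^k 4 (1 ℕ.+ 2 ℕ.* j)))
      where
      9^[2j]≡1 : (+ 9) ^ (2 ℕ.* j) ≡ + 1 mod + 16
      9^[2j]≡1 = subst (λ a → a ≡ + 1 mod + 16) (^-*-assoc (+ 9) 2 j) (^-≡1-mod j (+ 5 , refl))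
      norm≡8-mod-16 : norm w x ≡ + 8 mod + 16
      norm≡8-mod-16 with ≡1-mod-8⇒square≡1-mod-16 w≡1-mod-8
                       | ≡mod-trans (x²≡9^j-mod-16 (2 ℕ.* j) w-odd x-odd norm≡) 9^[2j]≡1
      ... | a , w²≡1+16a | q , x²≡1+16q = a + + 7 * q , (begin
        w * w + + 7 * (x * x)                   ≡⟨ cong₂ (λ p s → p + + 7 * s) w²≡1+16a x²≡1+16q ⟩
        + 1 + + 16 * a + + 7 * (+ 1 + + 16 * q) ≡⟨ solve (a ∷ q ∷ []) ⟩
        + 8 + + 16 * (a + + 7 * q)              ∎)

open Norm using (_≡_mod_; _,_; norm; norm≢2^[5+2j]; pos-norm; pos-^; ^-≡1-mod)
open import Data.Integer.Base as ℤ using (+_)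
open import Data.Nat using (ℕ; zero; suc; _+_; _*_; _^_; _≤_; _<_; _%_; z≤n; s≤s)
open import Data.Nat.Properties
  using (+-comm; *-comm; *-identityʳ; *-suc; *-distribˡ-+; ^-*-assoc; ^-monoʳ-≤; m≤m+n; m≤n+m; <⇒≱)
open import Data.Nat.DivMod using (m%n<n; %-distribˡ-*; %-remove-+ʳ)
open import Data.Nat.Divisibility using (_∣_; divides; ∣m⇒∣m*n)
open import Data.Nat.Tactic.RingSolver using (solve)

square≡^2 : ∀ n → n * n ≡ n ^ 2
square≡^2 n = cong (n *_) (sym (*-identityʳ n))

even-or-odd : ∀ n → (∃ λ m → n ≡ 2 * m) ⊎ (∃ λ m → n ≡ 1 + 2 * m)
even-or-odd zero = inj₁ (0 , refl)
even-or-odd (suc n) with even-or-odd n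
... | inj₁ (m , n≡2m)   = inj₂ (m , cong suc n≡2m)
... | inj₂ (m , n≡1+2m) = inj₁ (suc m , trans (cong suc n≡1+2m) (sym (*-suc 2 m)))

4^n%5≡1⊎≡4 : ∀ n → 4 ^ n % 5 ≡ 1 ⊎ 4 ^ n % 5 ≡ 4
4^n%5≡1⊎≡4 zero = inj₁ refl
4^n%5≡1⊎≡4 (suc n) with 4^n%5≡1⊎≡4 n
... | inj₁ 4^n%5≡1 = inj₂ (trans (%-distribˡ-* 4 (4 ^ n) 5) (cong (λ r → 4 * r % 5) 4^n%5≡1))
... | inj₂ 4^n%5≡4 = inj₁ (trans (%-distribˡ-* 4 (4 ^ n) 5) (cong (λ r → 4 * r % 5) 4^n%5≡4))

7x²%5≡2[x%5]²%5 : ∀ x → 7 * (x * x) % 5 ≡ 2 * (x % 5 * (x % 5) % 5) % 5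
7x²%5≡2[x%5]²%5 x = trans (%-distribˡ-* 7 (x * x) 5) (cong (λ r → 2 * r % 5) (%-distribˡ-* x x 5))

2r²%5≢1×≢4 : ∀ r → r < 5 → 2 * (r * r % 5) % 5 ≢ 1 × 2 * (r * r % 5) % 5 ≢ 4
2r²%5≢1×≢4 0 _ = (λ ()) , (λ ())
2r²%5≢1×≢4 1 _ = (λ ()) , (λ ())
2r²%5≢1×≢4 2 _ = (λ ()) , (λ ())
2r²%5≢1×≢4 3 _ = (λ ()) , (λ ())
2r²%5≢1×≢4 4 _ = (λ ()) , (λ ())
2r²%5≢1×≢4 (suc (suc (suc (suc (suc _))))) (s≤s (s≤s (s≤s (s≤s (s≤s ())))))

7x²%5≢4^n%5 : ∀ x n → 7 * (x * x) % 5 ≢ 4 ^ n % 5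
7x²%5≢4^n%5 x n 7x²≡4^n with 2r²%5≢1×≢4 (x % 5) (m%n<n x 5) | 4^n%5≡1⊎≡4 n
... | ≢1 , _ | inj₁ 4^n≡1 = ≢1 (trans (sym (7x²%5≡2[x%5]²%5 x)) (trans 7x²≡4^n 4^n≡1))
... | _ , ≢4 | inj₂ 4^n≡4 = ≢4 (trans (sym (7x²%5≡2[x%5]²%5 x)) (trans 7x²≡4^n 4^n≡4))

7x²+25^[2y]≢2^[2m+2] : ∀ x y m → 7 * x ^ 2 + 25 ^ (2 * suc y) ≢ 2 ^ (2 * m + 2)
7x²+25^[2y]≢2^[2m+2] x y m eq = 7x²%5≢4^n%5 x (m + 1) (begin
  7 * (x * x) % 5                    ≡⟨ cong (λ s → 7 * s % 5) (square≡^2 x) ⟩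
  7 * x ^ 2 % 5                      ≡⟨ %-remove-+ʳ (7 * x ^ 2) 5∣25^[2y] ⟨
  (7 * x ^ 2 + 25 ^ (2 * suc y)) % 5 ≡⟨ cong (_% 5) eq ⟩
  2 ^ (2 * m + 2) % 5                ≡⟨ cong (λ k → 2 ^ k % 5) (*-distribˡ-+ 2 m 1) ⟨
  2 ^ (2 * (m + 1)) % 5              ≡⟨ cong (_% 5) (^-*-assoc 2 2 (m + 1)) ⟨
  4 ^ (m + 1) % 5                    ∎)
  where
  open ≡-Reasoning
  5∣25^[2y] : 5 ∣ 25 ^ (2 * suc y)
  5∣25^[2y] = ∣m⇒∣m*n {m = 25} (25 ^ (y + suc (y + 0))) (divides 5 refl)

7x²+25^[2y]≢8 : ∀ x y → 7 * x ^ 2 + 25 ^ (2 * suc y) ≢ 8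
7x²+25^[2y]≢8 x y eq = <⇒≱ (m≤m+n 9 16) (begin
  25                           ≤⟨ ^-monoʳ-≤ 25 {1} {2 * suc y} (s≤s z≤n) ⟩
  25 ^ (2 * suc y)             ≤⟨ m≤n+m (25 ^ (2 * suc y)) (7 * x ^ 2) ⟩
  7 * x ^ 2 + 25 ^ (2 * suc y) ≡⟨ eq ⟩
  8                            ∎)
  where open Data.Nat.Properties.≤-Reasoning

7x²+25^[2y]≢2^[5+2m] : ∀ x y m → 7 * x ^ 2 + 25 ^ (2 * y) ≢ 2 ^ (5 + 2 * m)
7x²+25^[2y]≢2^[5+2m] x y m eq = norm≢2^[5+2j] m (+ x) 25^y≡1-mod-8 (begin
  norm (+ (25 ^ y)) (+ x)           ≡⟨ pos-norm (25 ^ y) x ⟨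
  + (25 ^ y * 25 ^ y + 7 * (x * x)) ≡⟨ cong +_ (+-comm (25 ^ y * 25 ^ y) (7 * (x * x))) ⟩
  + (7 * (x * x) + 25 ^ y * 25 ^ y) ≡⟨ cong₂ (λ a b → + (7 * a + b)) (square≡^2 x) (square≡^2 (25 ^ y)) ⟩
  + (7 * x ^ 2 + (25 ^ y) ^ 2)      ≡⟨ cong (λ k → + (7 * x ^ 2 + k)) 25^y^2≡25^[2y] ⟩
  + (7 * x ^ 2 + 25 ^ (2 * y))      ≡⟨ cong +_ eq ⟩
  + (2 ^ (5 + 2 * m))               ≡⟨ pos-^ 2 (5 + 2 * m) ⟩
  (+ 2) ℤ.^ (5 + 2 * m)             ∎)
  where
  open ≡-Reasoning
  25^y≡1-mod-8 : + (25 ^ y) ≡ + 1 mod + 8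
  25^y≡1-mod-8 = subst (λ a → a ≡ + 1 mod + 8) (sym (pos-^ 25 y)) (^-≡1-mod y (+ 3 , refl))
  25^y^2≡25^[2y] : (25 ^ y) ^ 2 ≡ 25 ^ (2 * y)
  25^y^2≡25^[2y] = trans (^-*-assoc 25 y 2) (cong (25 ^_) (*-comm y 2))

lemma4p3 : (x y z : ℕ) → 1 ≤ x → 1 ≤ y → 1 ≤ z →
           ¬ (7 * x ^ 2 + 25 ^ (2 * y) ≡ 2 ^ (z + 2))
lemma4p3 x zero    z _ () _
lemma4p3 x (suc y) z _ _  _ eq with even-or-odd z
... | inj₁ (m , refl)     = 7x²+25^[2y]≢2^[2m+2] x y m eq
... | inj₂ (zero , refl)  = 7x²+25^[2y]≢8 x y eq
... | inj₂ (suc m , refl) = 7x²+25^[2y]≢2^[5+2m] x (suc y) m (trans eq (cong (2 ^_) z+2≡5+2m))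
  where
  z+2≡5+2m : 1 + 2 * suc m + 2 ≡ 5 + 2 * m
  z+2≡5+2m = solve (m ∷ [])
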